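{- Let $w\in S_n$ be a non-identity permutation. Then the position $a=\max\{p:\lambda_w(p)=p\neq\rho_w(p)\}$ exists, and $[a,\rho_w(a)]$ is a strong right-descent interval of $w$ unless $w$ realizes the pattern $4231$ in positions $p_4<p_2<p_3=p_2+1<p_1$ (i.e.\ $w(p_4)>w(p_3)>w(p_2)>w(p_1)$). In particular, every non-identity $4231$-avoiding permutation has a strong right-descent interval.
   Context: Permutations are functions on positions $\{1,\dots,n\}$. $\lambda_w(p)$ is the unique position $q\le p$ maximizing $w(q)$ among positions $\le p$; $\rho_w(p)$ is the unique position $q\ge p$ minimizing $w(q)$ among positions $\ge p$. An interval $[a,b]$ with $a<b$ is a strong right-descent interval of $w$ if $w(a)>w(a+1)>\dots>w(b)$, $\lambda_w(a)=a$ (i.e.\ $w(q)<w(a)$ for all $q<a$) and $\rho_w(b)=b$ (i.e.\ $w(q)>w(b)$ for all $q>b$). -}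

module Defs where

open import Data.Nat using (ℕ; suc)
open import Data.Fin using (Fin; toℕ; _≤_; _<_)
open import Data.Fin.Permutation using (Permutation′; _⟨$⟩ʳ_)
open import Data.Product using (Σ; _×_; ∃-syntax)
open import Relation.Binary.PropositionalEquality using (_≡_)
open import Relation.Nullary using (¬_)

-- Positions are Fin n (0-indexed); w(p) is  w ⟨$⟩ʳ p.

IsIdentity : ∀ {n} → Permutation′ n → Set
IsIdentity {n} w = (i : Fin n) → w ⟨$⟩ʳ i ≡ i

IsLambda : ∀ {n} → Permutation′ n → Fin n → Fin n → Set
IsLambda {n} w p q = q ≤ p × ((r : Fin n) → r ≤ p → w ⟨$⟩ʳ r ≤ w ⟨$⟩ʳ q)

IsRho : ∀ {n} → Permutation′ n → Fin n → Fin n → Set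
IsRho {n} w p q = p ≤ q × ((r : Fin n) → p ≤ r → w ⟨$⟩ʳ q ≤ w ⟨$⟩ʳ r)

StrongRDI : ∀ {n} → Permutation′ n → Fin n → Fin n → Set
StrongRDI {n} w a b =
  a < b
  × ((i j : Fin n) → toℕ j ≡ suc (toℕ i) → a ≤ i → j ≤ b → w ⟨$⟩ʳ j < w ⟨$⟩ʳ i)
  × ((q : Fin n) → q < a → w ⟨$⟩ʳ q < w ⟨$⟩ʳ a)
  × ((q : Fin n) → b < q → w ⟨$⟩ʳ b < w ⟨$⟩ʳ q)

Adjacent4231 : ∀ {n} → Permutation′ n → Set
Adjacent4231 {n} w =
  ∃[ p4 ] ∃[ p2 ] ∃[ p3 ] ∃[ p1 ]
    (p4 < p2 × toℕ p3 ≡ suc (toℕ p2) × p3 < p1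
     × w ⟨$⟩ʳ p3 < w ⟨$⟩ʳ p4 × w ⟨$⟩ʳ p2 < w ⟨$⟩ʳ p3 × w ⟨$⟩ʳ p1 < w ⟨$⟩ʳ p2)

Contains4231 : ∀ {n} → Permutation′ n → Set
Contains4231 {n} w =
  ∃[ i ] ∃[ j ] ∃[ k ] ∃[ l ]
    (i < j × j < k × k < l
     × w ⟨$⟩ʳ k < w ⟨$⟩ʳ i × w ⟨$⟩ʳ j < w ⟨$⟩ʳ k × w ⟨$⟩ʳ l < w ⟨$⟩ʳ j)

Candidate : ∀ {n} → Permutation′ n → Fin n → Set
Candidate w p = IsLambda w p p × ¬ IsRho w p p

{-# OPTIONS --safe #-}
-- Candidates are left-to-right maxima that are not right-to-left minima; the least
-- position moved by w is one, so a greatest candidate a exists. Let b = ρ_w(a) and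
-- suppose w(i) < w(i+1) for some a ≤ i < b. The position m = λ_w(i+1) is again a
-- candidate (b lies to its right with a smaller value), so m ≤ a and hence
-- w(i+1) ≤ w(m) < w(a). Then a < i < i+1 < b carry the adjacent pattern 4231.
module Submission where

open import Defs
open import Data.Nat using (ℕ; z≤n; s≤s)
import Data.Nat as ℕ
import Data.Nat.Properties as ℕ
open import Data.Fin using (Fin; zero; suc; toℕ; _≤_; _<_)
open import Data.Fin.Properties
  using (any?; all?; ¬∀⟶∃¬; _≟_; _≤?_; _<?_; ≤-refl; ≤-reflexive; ≤-trans; <-trans; <⇒≢; ≤∧≢⇒<; <-cmp)
open import Data.Fin.Permutation using (Permutation′; _⟨$⟩ʳ_; _⟨$⟩ˡ_; inverseˡ; inverseʳ)
open import Data.Product using (_×_; ∃; ∃-syntax; _,_; proj₁; proj₂)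
open import Data.Empty using (⊥-elim)
open import Function using (_∘_)
open import Function.Bundles using (Injection)
open import Function.Properties.Inverse using (↔⇒↣)
open import Level using (Level)
open import Relation.Binary using (tri<; tri≈; tri>)
open import Relation.Binary.PropositionalEquality using (_≡_; _≢_; refl; sym; trans; cong; subst)
open import Relation.Nullary using (¬_; Dec; yes; no)
open import Relation.Nullary.Decidable using (_×-dec_; _→-dec_; ¬?)
open import Relation.Unary using (Pred; Decidable)

private
  variable
    ℓ : Level
    n : ℕ

Least : Pred (Fin n) ℓ → Fin n → Set ℓ
Least P a = P a × (∀ {p} → P p → a ≤ p)

Greatest : Pred (Fin n) ℓ → Fin n → Set ℓ
Greatest P a = P a × (∀ {p} → P p → p ≤ a)

least : {P : Pred (Fin n) ℓ} → Decidable P → ∃ P → ∃ (Least P)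
least {n = ℕ.suc n} P? p with P? zero
... | yes P0 = zero , P0 , λ _ → z≤n
least {n = ℕ.suc n} P? (zero , P0) | no ¬P0 = ⊥-elim (¬P0 P0)
least {n = ℕ.suc n} P? (suc p , Pp) | no ¬P0 with least (P? ∘ suc) (p , Pp)
... | a , Pa , a-least = suc a , Pa , λ { {zero} P0 → ⊥-elim (¬P0 P0) ; {suc q} Pq → s≤s (a-least Pq) }

greatest : {P : Pred (Fin n) ℓ} → Decidable P → ∃ P → ∃ (Greatest P)
greatest {n = ℕ.suc n} P? p with any? (P? ∘ suc)
... | yes p′ with greatest (P? ∘ suc) p′
...   | a , Pa , a-greatest = suc a , Pa , λ { {zero} _ → z≤n ; {suc q} Pq → s≤s (a-greatest Pq) }
greatest {n = ℕ.suc n} P? (zero , P0) | no ¬P+ = zero , P0 , λ { {zero} _ → z≤n ; {suc q} Pq → ⊥-elim (¬P+ (q , Pq)) }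
greatest {n = ℕ.suc n} P? (suc p , Pp) | no ¬P+ = ⊥-elim (¬P+ (p , Pp))

adjacent4231⇒contains4231 : {w : Permutation′ n} → Adjacent4231 w → Contains4231 w
adjacent4231⇒contains4231 (p₄ , p₂ , p₃ , p₁ , p₄<p₂ , p₃≡1+p₂ , rest) =
  p₄ , p₂ , p₃ , p₁ , p₄<p₂ , ℕ.≤-reflexive (sym p₃≡1+p₂) , rest

module _ {n : ℕ} (w : Permutation′ n) where

  private
    w[_] : Fin n → Fin n
    w[ p ] = w ⟨$⟩ʳ p

  w-injective : ∀ {p q} → w[ p ] ≡ w[ q ] → p ≡ q
  w-injective = Injection.injective (↔⇒↣ w)

  w-strict : ∀ {p q} → p ≢ q → w[ p ] ≤ w[ q ] → w[ p ] < w[ q ]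
  w-strict p≢q wp≤wq = ≤∧≢⇒< wp≤wq (p≢q ∘ w-injective)

  isLambda? : ∀ p q → Dec (IsLambda w p q)
  isLambda? p q = (q ≤? p) ×-dec all? (λ r → (r ≤? p) →-dec (w[ r ] ≤? w[ q ]))

  isRho? : ∀ p q → Dec (IsRho w p q)
  isRho? p q = (p ≤? q) ×-dec all? (λ r → (p ≤? r) →-dec (w[ q ] ≤? w[ r ]))

  candidate? : Decidable (Candidate w)
  candidate? p = isLambda? p p ×-dec ¬? (isRho? p p)

  isLambda-self : ∀ {p q} → IsLambda w p q → IsLambda w q q
  isLambda-self (q≤p , q-max) = ≤-refl , λ r r≤q → q-max r (≤-trans r≤q q≤p)

  later-smaller⇒¬isRho-self : ∀ {p r} → p < r → w[ r ] < w[ p ] → ¬ IsRho w p p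
  later-smaller⇒¬isRho-self p<r wr<wp (_ , p-min) = ℕ.<⇒≱ wr<wp (p-min _ (ℕ.<⇒≤ p<r))

  prefixMax : ∀ p → ∃ (IsLambda w p)
  prefixMax p with greatest (λ v → w ⟨$⟩ˡ v ≤? p) (w[ p ] , ≤-reflexive (inverseˡ w))
  ... | v , v≤p , v-greatest = w ⟨$⟩ˡ v , v≤p , λ r r≤p →
    subst (w[ r ] ≤_) (sym (inverseʳ w)) (v-greatest (subst (_≤ p) (sym (inverseˡ w)) r≤p))

  suffixMin : ∀ p → ∃ (IsRho w p)
  suffixMin p with least (λ v → p ≤? w ⟨$⟩ˡ v) (w[ p ] , ≤-reflexive (sym (inverseˡ w)))
  ... | v , p≤v , v-least = w ⟨$⟩ˡ v , p≤v , λ r p≤r →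
    subst (_≤ w[ r ]) (sym (inverseʳ w)) (v-least (subst (p ≤_) (sym (inverseˡ w)) p≤r))

  candidate-exists : ¬ IsIdentity w → ∃ (Candidate w)
  candidate-exists w≢id with least (λ p → ¬? (w[ p ] ≟ p)) (¬∀⟶∃¬ n _ (λ p → w[ p ] ≟ p) w≢id)
  ... | i , wi≢i , i-least = i , (≤-refl , i-leftMax) , later-smaller⇒¬isRho-self i<i′ wi′<wi
    where
    fixed-below : ∀ {r} → r < i → w[ r ] ≡ r
    fixed-below {r} r<i with w[ r ] ≟ r
    ... | yes wr≡r = wr≡r
    ... | no wr≢r = ⊥-elim (ℕ.<⇒≱ r<i (i-least wr≢r))

    i<wi : i < w[ i ]
    i<wi with <-cmp i w[ i ]
    ... | tri< i<wi _ _ = i<wi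
    ... | tri≈ _ i≡wi _ = ⊥-elim (wi≢i (sym i≡wi))
    ... | tri> _ _ wi<i = ⊥-elim (wi≢i (w-injective (fixed-below wi<i)))

    i-leftMax : ∀ r → r ≤ i → w[ r ] ≤ w[ i ]
    i-leftMax r r≤i with r ≟ i
    ... | yes refl = ≤-refl
    ... | no r≢i = subst (_≤ w[ i ]) (sym (fixed-below r<i)) (ℕ.<⇒≤ (<-trans r<i i<wi))
      where
      r<i : r < i
      r<i = ≤∧≢⇒< r≤i r≢i

    i′ : Fin n
    i′ = w ⟨$⟩ˡ i

    wi′<wi : w[ i′ ] < w[ i ]
    wi′<wi = subst (_< w[ i ]) (sym (inverseʳ w)) i<wi

    i<i′ : i < i′
    i<i′ with <-cmp i i′
    ... | tri< i<i′ _ _ = i<i′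
    ... | tri≈ _ i≡i′ _ = ⊥-elim (wi≢i (trans (cong w[_] i≡i′) (inverseʳ w)))
    ... | tri> _ _ i′<i = ⊥-elim (<⇒≢ i′<i (trans (sym (fixed-below i′<i)) (inverseʳ w)))

  ascent⇒adjacent4231 : ∀ {a b i j} → IsLambda w a a → (∀ {p} → Candidate w p → p ≤ a) → IsRho w a b →
    a ≤ i → toℕ j ≡ ℕ.suc (toℕ i) → j ≤ b → w[ i ] < w[ j ] → Adjacent4231 w
  ascent⇒adjacent4231 {a} {b} {i} {j} (_ , a-leftMax) a-maximal (_ , b-min) a≤i j≡1+i j≤b wi<wj =
    a , i , j , b , a<i , j≡1+i , j<b , wj<wa , wi<wj , w-strict (<⇒≢ i<b ∘ sym) wb≤wi
    where
    i<j : i < j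
    i<j = ℕ.≤-reflexive (sym j≡1+i)

    wb≤wi : w[ b ] ≤ w[ i ]
    wb≤wi = b-min i a≤i

    j<b : j < b
    j<b = ≤∧≢⇒< j≤b λ { refl → ℕ.<-irrefl refl (ℕ.≤-<-trans wb≤wi wi<wj) }

    i<b : i < b
    i<b = <-trans i<j j<b

    m : Fin n
    m = proj₁ (prefixMax j)

    m-isLambda : IsLambda w j m
    m-isLambda = proj₂ (prefixMax j)

    m-candidate : Candidate w m
    m-candidate = isLambda-self m-isLambda ,
      later-smaller⇒¬isRho-self (ℕ.≤-<-trans (proj₁ m-isLambda) j<b)
        (ℕ.≤-<-trans wb≤wi (ℕ.<-≤-trans wi<wj (proj₂ m-isLambda j ≤-refl)))

    wj<wa : w[ j ] < w[ a ]
    wj<wa = w-strict (<⇒≢ (ℕ.≤-<-trans a≤i i<j) ∘ sym)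
      (≤-trans (proj₂ m-isLambda j ≤-refl) (a-leftMax m (a-maximal m-candidate)))

    a<i : a < i
    a<i = ≤∧≢⇒< a≤i λ { refl → ℕ.<-asym wi<wj wj<wa }

  greatestCandidate⇒strongRDI : ∀ {a b} → Greatest (Candidate w) a → IsRho w a b →
    ¬ Adjacent4231 w → StrongRDI w a b
  greatestCandidate⇒strongRDI {a} {b} ((a-isLambda , ¬ρa≡a) , a-maximal) b-isRho@(a≤b , b-min) no4231 =
    ≤∧≢⇒< a≤b (λ { refl → ¬ρa≡a b-isRho }) , descending , leftMax , rightMin
    where
    descending : ∀ i j → toℕ j ≡ ℕ.suc (toℕ i) → a ≤ i → j ≤ b → w[ j ] < w[ i ]
    descending i j j≡1+i a≤i j≤b with w[ j ] <? w[ i ]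
    ... | yes wj<wi = wj<wi
    ... | no wj≮wi = ⊥-elim (no4231 (ascent⇒adjacent4231 a-isLambda a-maximal b-isRho a≤i j≡1+i j≤b
            (w-strict (<⇒≢ (ℕ.≤-reflexive (sym j≡1+i))) (ℕ.≮⇒≥ wj≮wi))))

    leftMax : ∀ q → q < a → w[ q ] < w[ a ]
    leftMax q q<a = w-strict (<⇒≢ q<a) (proj₂ a-isLambda q (ℕ.<⇒≤ q<a))

    rightMin : ∀ q → b < q → w[ b ] < w[ q ]
    rightMin q b<q = w-strict (<⇒≢ b<q) (b-min q (≤-trans a≤b (ℕ.<⇒≤ b<q)))

mainTheorem4 : (n : ℕ) (w : Permutation′ n) → ¬ IsIdentity w →
    (∃[ a ] ∃[ b ]
      (Candidate w a
       × ((p : Fin n) → Candidate w p → p ≤ a)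
       × IsRho w a b
       × (¬ Adjacent4231 w → StrongRDI w a b)))
    × (¬ Contains4231 w → ∃[ a ] ∃[ b ] StrongRDI w a b)
mainTheorem4 n w w≢id with greatest (candidate? w) (candidate-exists w w≢id)
... | a , a-candidate , a-maximal with suffixMin w a
...   | b , b-isRho =
  (a , b , a-candidate , (λ _ → a-maximal) , b-isRho , strongRDI) ,
  λ no4231 → a , b , strongRDI (no4231 ∘ adjacent4231⇒contains4231 {w = w})
  where
  strongRDI : ¬ Adjacent4231 w → StrongRDI w a b
  strongRDI = greatestCandidate⇒strongRDI w (a-candidate , a-maximal) b-isRho
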